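{- Let $\mathcal{P}$ be the Petersen graph. Then $L(\mathcal{P})$ has a proper Galvin orientation with respect to $\chi'(\mathcal{P})=4$.
   Context: A $k$-edge-colouring is an assignment of colours from $\{1,\dots,k\}$ to edges so that adjacent edges get different colours; $\chi'$ is the chromatic index. The line graph $L(G)$ has vertex set $E(G)$, and two edges $e,f$ of $G$ are joined in $L(G)$ by as many edges as the number of ends they share in $G$; each edge of $L(G)$ corresponds to a common incidence of its two ends at a vertex of $G$. Given a partition of $V(G)$ into sets $U$ and $D$ and a $k$-edge-colouring $\varphi$ of $G$, the Galvin orientation of $L(G)$ is defined as follows: for an edge of $L(G)$ with ends $e_1,e_2$, where $\varphi(e_1)<\varphi(e_2)$, corresponding to a common incidence at a vertex $x$ of $G$: if $x\in D$ it is oriented from $e_2$ to $e_1$, and if $x\in U$ it is oriented from $e_1$ to $e_2$. A kernel of a digraph is an independent set $K$ such that every vertex outside $K$ has an out-edge into $K$; a digraph is kernel-perfect if every induced subdigraph has a kernel. The Galvin orientation is proper if it is kernel-perfect and every vertex has outdegree at most $k-1$. $L(G)$ has a proper Galvin orientation with respect to $k$ if there exist a partition $(U,D)$ of $V(G)$ and a $k$-edge-colouring $\varphi$ of $G$ whose Galvin orientation is proper. -}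

module Defs where

open import Data.Nat using (ℕ; zero; suc; _<ᵇ_; _≤_)
open import Data.Nat.ListAction using (sum)
open import Data.Fin using (Fin; toℕ; _≟_; #_)
open import Data.Fin.Subset using (Subset; _∈_; _∉_; _⊆_)
open import Data.Bool using (Bool; true; false; _∧_; _∨_; not; if_then_else_; T)
open import Data.List using (List; map; allFin)
open import Data.Product using (_×_; _,_; proj₁; proj₂; Σ; ∃; ∃-syntax)
open import Relation.Nullary using (¬_; does)
open import Relation.Binary.PropositionalEquality using (_≡_; _≢_)

record Graph : Set where
  field
    V     : ℕ
    E     : ℕ
    ends  : Fin E → Fin V × Fin V
    loopless : ∀ e → proj₁ (ends e) ≢ proj₂ (ends e)
open Graph public

isEnd : (G : Graph) → Fin (V G) → Fin (E G) → Bool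
isEnd G x e = does (x ≟ proj₁ (ends G e)) ∨ does (x ≟ proj₂ (ends G e))

Adjacent : (G : Graph) → Fin (E G) → Fin (E G) → Set
Adjacent G e f = e ≢ f × ∃[ x ] T (isEnd G x e ∧ isEnd G x f)

IsEdgeColouring : (G : Graph) (k : ℕ) → (Fin (E G) → Fin k) → Set
IsEdgeColouring G k φ = ∀ e f → Adjacent G e f → φ e ≢ φ f

-- Partition (U, D) of V(G) is encoded by inU : Fin V → Bool
-- (inU x = true  means x ∈ U,  inU x = false  means x ∈ D).
-- The edges of L(G) are the common incidences: triples (e, f, x) with e ≠ f
-- and x an end of both.  galvinArcAt G φ inU e f x = true iff
-- the edge of L(G) between e and f corresponding to the incidence at x
-- is oriented from e to f in the Galvin orientation.
galvinArcAt : (G : Graph) {k : ℕ} → (Fin (E G) → Fin k) → (Fin (V G) → Bool) →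
              Fin (E G) → Fin (E G) → Fin (V G) → Bool
galvinArcAt G φ inU e f x =
  not (does (e ≟ f)) ∧ isEnd G x e ∧ isEnd G x f ∧
  (if inU x then toℕ (φ e) <ᵇ toℕ (φ f)
            else toℕ (φ f) <ᵇ toℕ (φ e))

GalvinArc : (G : Graph) {k : ℕ} → (Fin (E G) → Fin k) → (Fin (V G) → Bool) →
            Fin (E G) → Fin (E G) → Set
GalvinArc G φ inU e f = ∃[ x ] T (galvinArcAt G φ inU e f x)

-- Outdegree of e in the Galvin orientation (counting parallel edges of L(G)).
galvinOutdeg : (G : Graph) {k : ℕ} → (Fin (E G) → Fin k) → (Fin (V G) → Bool) →
               Fin (E G) → ℕ
galvinOutdeg G φ inU e =
  sum (map (λ f → sum (map (λ x → if galvinArcAt G φ inU e f x then 1 else 0)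
                            (allFin (V G))))
           (allFin (E G)))

IsKernelOf : {n : ℕ} → (Fin n → Fin n → Set) → Subset n → Subset n → Set
IsKernelOf {n} Arc S K =
  K ⊆ S ×
  (∀ u v → u ∈ K → v ∈ K → ¬ Arc u v) ×
  (∀ u → u ∈ S → u ∉ K → ∃[ v ] (v ∈ K × Arc u v))

KernelPerfect : {n : ℕ} → (Fin n → Fin n → Set) → Set
KernelPerfect {n} Arc = ∀ (S : Subset n) → ∃[ K ] IsKernelOf Arc S K

IsProperGalvin : (G : Graph) (k : ℕ) → (Fin (E G) → Fin k) → (Fin (V G) → Bool) → Set
IsProperGalvin G k φ inU =
  KernelPerfect (GalvinArc G φ inU) ×
  (∀ e → galvinOutdeg G φ inU e ≤ k Data.Nat.∸ 1)

HasProperGalvinOrientation : Graph → ℕ → Set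
HasProperGalvinOrientation G k =
  ∃[ inU ] ∃[ φ ] (IsEdgeColouring G k φ × IsProperGalvin G k φ inU)

-- The Petersen graph: outer 5-cycle 0-1-2-3-4-0, spokes i-(i+5),
-- inner pentagram (5+i)-(5+(i+2 mod 5)).
petersenTable : ℕ → Fin 10 × Fin 10
petersenTable 0  = # 0 , # 1
petersenTable 1  = # 1 , # 2
petersenTable 2  = # 2 , # 3
petersenTable 3  = # 3 , # 4
petersenTable 4  = # 4 , # 0
petersenTable 5  = # 0 , # 5
petersenTable 6  = # 1 , # 6
petersenTable 7  = # 2 , # 7
petersenTable 8  = # 3 , # 8
petersenTable 9  = # 4 , # 9
petersenTable 10 = # 5 , # 7
petersenTable 11 = # 6 , # 8
petersenTable 12 = # 7 , # 9
petersenTable 13 = # 8 , # 5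
petersenTable _  = # 9 , # 6

petersenTableLoopless : ∀ n → proj₁ (petersenTable n) ≢ proj₂ (petersenTable n)
petersenTableLoopless 0 ()
petersenTableLoopless 1 ()
petersenTableLoopless 2 ()
petersenTableLoopless 3 ()
petersenTableLoopless 4 ()
petersenTableLoopless 5 ()
petersenTableLoopless 6 ()
petersenTableLoopless 7 ()
petersenTableLoopless 8 ()
petersenTableLoopless 9 ()
petersenTableLoopless 10 ()
petersenTableLoopless 11 ()
petersenTableLoopless 12 ()
petersenTableLoopless 13 ()
petersenTableLoopless (suc (suc (suc (suc (suc (suc (suc (suc (suc (suc (suc (suc (suc (suc n)))))))))))))) ()

petersen : Graph
petersen = record
  { V = 10
  ; E = 15
  ; ends = λ e → petersenTable (toℕ e)
  ; loopless = λ e → petersenTableLoopless (toℕ e)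
  }

module Submission where

-- We exhibit a 4-edge-colouring φ of the Petersen graph and a
-- partition (U, D) of its vertices and show that the Galvin orientation of L(P)
-- they determine is proper.  That φ is a colouring and that every outdegree is
-- at most 3 are finite facts, decided by evaluation.  Kernel-perfectness rests
-- on a general fact about digraphs:
--
--   (sink extension)  if v ∈ S has no out-arc into S, then v together with any
--   kernel of S minus v and its in-neighbours is a kernel of S.
--
-- By induction on |S| this reduces kernel-perfectness of any digraph with
-- decidable arcs to its sink-free induced subdigraphs.  In our orientation,
-- tabulated as successor lists, a sink-free S lies among the 12 edges that have
-- out-arcs, and it has a kernel S ∩ T for one of four fixed sets T; this is
-- checked by evaluation over those 2¹² subsets.

open import Defs
open import Level using (0ℓ)
open import Data.Nat using (ℕ; _<_; _≤_; _≤?_; _∸_)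
open import Data.Nat.Induction using (<-wellFounded)
open import Induction.WellFounded using (Acc; acc)
open import Data.Bool using (Bool; true; false; _∧_; T)
open import Data.Bool.Properties using (T-∧; T-≡)
open import Data.Fin using (Fin; _≟_; #_)
open import Data.Fin.Properties using (all?; any?; ¬∀⟶∃¬)
open import Data.Fin.Subset using (Subset; _∈_; _∉_; _⊆_; _∪_; _∩_; ⁅_⁆; ⋃; ∣_∣)
open import Data.Fin.Subset.Properties
  using (_∈?_; _⊆?_; drop-∷-⊆; x∈⁅x⁆; x∈⁅y⁆⇒x≡y; x∈p∪q⁺; x∈p∪q⁻; p⊂q⇒∣p∣<∣q∣)
open import Data.List using (List; []; _∷_; map)
open import Data.List.Membership.Propositional using () renaming (_∈_ to _∈ₗ_)
open import Data.List.Relation.Unary.Any as Any using (Any)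
open import Data.Vec using ([]; _∷_; lookup; tabulate; here)
open import Data.Vec.Properties using (lookup∘tabulate; lookup⇒[]=; []=⇒lookup)
open import Data.Product using (_×_; _,_; proj₁; proj₂; ∃-syntax)
open import Data.Sum using (_⊎_; inj₁; inj₂)
open import Data.Empty using (⊥-elim)
open import Function using (_∘_; Equivalence)
open import Relation.Nullary using (¬_; Dec; yes; no; does)
open import Relation.Nullary.Decidable
  using (_×-dec_; _→-dec_; ¬?; T?; map′; from-yes; dec-true; decidable-stable)
open import Relation.Unary using (Pred)
import Relation.Unary as U
open import Relation.Binary using (Decidable)
open import Relation.Binary.PropositionalEquality using (_≡_; _≢_; refl; trans; sym)

subsetOf : ∀ {n} {P : Pred (Fin n) 0ℓ} → U.Decidable P → Subset n
subsetOf P? = tabulate (λ u → does (P? u))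

∈-subsetOf⁺ : ∀ {n} {P : Pred (Fin n) 0ℓ} (P? : U.Decidable P) {u} → P u → u ∈ subsetOf P?
∈-subsetOf⁺ P? {u} p = lookup⇒[]= u _ (trans (lookup∘tabulate _ u) (dec-true (P? u) p))

∈-subsetOf⁻ : ∀ {n} {P : Pred (Fin n) 0ℓ} (P? : U.Decidable P) {u} → u ∈ subsetOf P? → P u
∈-subsetOf⁻ P? {u} u∈ with P? u | trans (sym (lookup∘tabulate _ u)) ([]=⇒lookup u∈)
... | yes p | _  = p
... | no _  | ()

allSubsetsOf : ∀ {n} → Subset n → (Subset n → Bool) → Bool
allSubsetsOf []          test = test []
allSubsetsOf (true ∷ C)  test = allSubsetsOf C (test ∘ (true ∷_)) ∧ allSubsetsOf C (test ∘ (false ∷_))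
allSubsetsOf (false ∷ C) test = allSubsetsOf C (test ∘ (false ∷_))

allSubsetsOf-sound : ∀ {n} (C : Subset n) test → T (allSubsetsOf C test) → ∀ S → S ⊆ C → T (test S)
allSubsetsOf-sound []          test holds []         _   = holds
allSubsetsOf-sound (true ∷ C)  test holds (true ∷ S) S⊆C =
  allSubsetsOf-sound C (test ∘ (true ∷_)) (proj₁ (Equivalence.to T-∧ holds)) S (drop-∷-⊆ S⊆C)
allSubsetsOf-sound (true ∷ C)  test holds (false ∷ S) S⊆C =
  allSubsetsOf-sound C (test ∘ (false ∷_)) (proj₂ (Equivalence.to T-∧ holds)) S (drop-∷-⊆ S⊆C)
allSubsetsOf-sound (false ∷ C) test holds (true ∷ S) S⊆C with S⊆C here
... | ()
allSubsetsOf-sound (false ∷ C) test holds (false ∷ S) S⊆C =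
  allSubsetsOf-sound C (test ∘ (false ∷_)) holds S (drop-∷-⊆ S⊆C)

everySubsetOf : ∀ {n} {P : Pred (Subset n) 0ℓ} (P? : U.Decidable P) (C : Subset n) →
                allSubsetsOf C (does ∘ P?) ≡ true → ∀ S → S ⊆ C → P S
everySubsetOf P? C holds S S⊆C
  with P? S | allSubsetsOf-sound C (does ∘ P?) (Equivalence.from T-≡ holds) S S⊆C
... | yes p | _  = p
... | no _  | ()

module Kernels {n : ℕ} {Arc : Fin n → Fin n → Set} (arc? : Decidable Arc) where

  IsSinkOf : Subset n → Fin n → Set
  IsSinkOf S v = ∀ w → w ∈ S → ¬ Arc v w

  SinkFree : Subset n → Set
  SinkFree S = ∀ u → u ∈ S → ∃[ w ] (w ∈ S × Arc u w)

  Remains : Subset n → Fin n → Pred (Fin n) 0ℓ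
  Remains S v u = u ∈ S × u ≢ v × ¬ Arc u v

  remains? : ∀ S v → U.Decidable (Remains S v)
  remains? S v u = u ∈? S ×-dec ¬? (u ≟ v) ×-dec ¬? (arc? u v)

  remove : Subset n → Fin n → Subset n
  remove S v = subsetOf (remains? S v)

  remove-shrinks : ∀ {S v} → v ∈ S → ∣ remove S v ∣ < ∣ S ∣
  remove-shrinks {S} {v} v∈S = p⊂q⇒∣p∣<∣q∣ (remove⊆S , v , v∈S , v∉remove)
    where
    remove⊆S : remove S v ⊆ S
    remove⊆S = proj₁ ∘ ∈-subsetOf⁻ (remains? S v)
    v∉remove : v ∉ remove S v
    v∉remove v∈ = proj₁ (proj₂ (∈-subsetOf⁻ (remains? S v) v∈)) refl

  sinkExtension : ∀ {S v K} → v ∈ S → IsSinkOf S v →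
                  IsKernelOf Arc (remove S v) K → IsKernelOf Arc S (K ∪ ⁅ v ⁆)
  sinkExtension {S} {v} {K} v∈S sink (K⊆rest , independent , absorbing) =
    K′⊆S , independent′ , absorbing′
    where
    remains : ∀ {u} → u ∈ K → Remains S v u
    remains = ∈-subsetOf⁻ (remains? S v) ∘ K⊆rest

    split : ∀ {u} → u ∈ K ∪ ⁅ v ⁆ → u ∈ K ⊎ u ≡ v
    split u∈ with x∈p∪q⁻ K ⁅ v ⁆ u∈
    ... | inj₁ u∈K = inj₁ u∈K
    ... | inj₂ u∈v = inj₂ (x∈⁅y⁆⇒x≡y v u∈v)

    v∈K′ : v ∈ K ∪ ⁅ v ⁆
    v∈K′ = x∈p∪q⁺ (inj₂ (x∈⁅x⁆ v))

    K′⊆S : K ∪ ⁅ v ⁆ ⊆ S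
    K′⊆S u∈ with split u∈
    ... | inj₁ u∈K = proj₁ (remains u∈K)
    ... | inj₂ refl = v∈S

    independent′ : ∀ u w → u ∈ K ∪ ⁅ v ⁆ → w ∈ K ∪ ⁅ v ⁆ → ¬ Arc u w
    independent′ u w u∈ w∈ with split u∈ | split w∈
    ... | inj₂ refl | _         = sink w (K′⊆S w∈)
    ... | inj₁ u∈K  | inj₂ refl = proj₂ (proj₂ (remains u∈K))
    ... | inj₁ u∈K  | inj₁ w∈K  = independent u w u∈K w∈K

    absorbing′ : ∀ u → u ∈ S → u ∉ K ∪ ⁅ v ⁆ → ∃[ w ] (w ∈ K ∪ ⁅ v ⁆ × Arc u w)
    absorbing′ u u∈S u∉K′ with arc? u v
    ... | yes u→v = v , v∈K′ , u→v
    ... | no ¬u→v with absorbing u u∈rest (u∉K′ ∘ x∈p∪q⁺ ∘ inj₁)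
      where
      u≢v : u ≢ v
      u≢v refl = u∉K′ v∈K′
      u∈rest : u ∈ remove S v
      u∈rest = ∈-subsetOf⁺ (remains? S v) (u∈S , u≢v , ¬u→v)
    ... | w , w∈K , u→w = w , x∈p∪q⁺ (inj₁ w∈K) , u→w

  sinkOrSinkFree : ∀ S → ∃[ v ] (v ∈ S × IsSinkOf S v) ⊎ SinkFree S
  sinkOrSinkFree S with any? (λ v → v ∈? S ×-dec all? (λ w → w ∈? S →-dec ¬? (arc? v w)))
  ... | yes sink = inj₁ sink
  ... | no noSink = inj₂ outArc
    where
    outArc : SinkFree S
    outArc u u∈S with ¬∀⟶∃¬ n _ (λ w → w ∈? S →-dec ¬? (arc? u w)) (λ sink → noSink (u , u∈S , sink))
    ... | w , ¬noArc = w , decidable-stable (w ∈? S) (λ w∉S → ¬noArc (⊥-elim ∘ w∉S))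
                         , decidable-stable (arc? u w) (λ ¬u→w → ¬noArc (λ _ → ¬u→w))

  -- A digraph is kernel-perfect as soon as its sink-free induced subdigraphs
  -- have kernels: peel off sinks by induction on the size of the vertex set.
  kernelPerfect : (∀ S → SinkFree S → ∃[ K ] IsKernelOf Arc S K) → KernelPerfect Arc
  kernelPerfect sinkFreeKernel S = kernelOf S (<-wellFounded ∣ S ∣)
    where
    kernelOf : ∀ S → Acc _<_ ∣ S ∣ → ∃[ K ] IsKernelOf Arc S K
    kernelOf S (acc smaller) with sinkOrSinkFree S
    ... | inj₂ sinkFree = sinkFreeKernel S sinkFree
    ... | inj₁ (v , v∈S , sink) with kernelOf (remove S v) (smaller (remove-shrinks v∈S))
    ... | K , kernel = K ∪ ⁅ v ⁆ , sinkExtension v∈S sink kernel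

  nonSinks : Subset n
  nonSinks = subsetOf (λ u → any? (arc? u))

  sinkFree⊆nonSinks : ∀ {S} → SinkFree S → S ⊆ nonSinks
  sinkFree⊆nonSinks sinkFree {u} u∈S with sinkFree u u∈S
  ... | w , _ , u→w = ∈-subsetOf⁺ (λ u → any? (arc? u)) (w , u→w)

  sinkFree? : U.Decidable SinkFree
  sinkFree? S = all? λ u → u ∈? S →-dec any? λ w → w ∈? S ×-dec arc? u w

  isKernel? : Decidable (IsKernelOf Arc)
  isKernel? S K =
    K ⊆? S ×-dec
    (all? λ u → all? λ w → u ∈? K →-dec w ∈? K →-dec ¬? (arc? u w)) ×-dec
    (all? λ u → u ∈? S →-dec ¬? (u ∈? K) →-dec any? λ w → w ∈? K ×-dec arc? u w)

module _ (G : Graph) where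

  adjacent? : Decidable (Adjacent G)
  adjacent? e f = ¬? (e ≟ f) ×-dec any? (λ x → T? (isEnd G x e ∧ isEnd G x f))

  isEdgeColouring? : (k : ℕ) (φ : Fin (E G) → Fin k) → Dec (IsEdgeColouring G k φ)
  isEdgeColouring? k φ = all? λ e → all? λ f → adjacent? e f →-dec ¬? (φ e ≟ φ f)

  galvinArc? : ∀ {k} (φ : Fin (E G) → Fin k) (inU : Fin (V G) → Bool) → Decidable (GalvinArc G φ inU)
  galvinArc? φ inU e f = any? λ x → T? (galvinArcAt G φ inU e f x)

  outdegreeBounded? : (k : ℕ) (φ : Fin (E G) → Fin k) (inU : Fin (V G) → Bool) →
                      Dec (∀ e → galvinOutdeg G φ inU e ≤ k ∸ 1)
  outdegreeBounded? k φ inU = all? λ e → galvinOutdeg G φ inU e ≤? k ∸ 1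

-- Colours 0..3 of the edges, in the order of petersenTable.
φ : Fin 15 → Fin 4
φ = lookup (# 0 ∷ # 1 ∷ # 0 ∷ # 3 ∷ # 1 ∷ # 2 ∷ # 2 ∷ # 2 ∷ # 2 ∷ # 2 ∷ # 3 ∷ # 0 ∷ # 0 ∷ # 1 ∷ # 1 ∷ [])

inU : Fin 10 → Bool
inU = lookup (false ∷ true ∷ false ∷ true ∷ true ∷ true ∷ true ∷ true ∷ false ∷ false ∷ [])

successors : Fin 15 → List (Fin 15)
successors = lookup
  ( (# 1 ∷ # 6 ∷ [])
  ∷ (# 2 ∷ # 6 ∷ [])
  ∷ (# 3 ∷ # 8 ∷ [])
  ∷ []
  ∷ (# 0 ∷ # 3 ∷ # 9 ∷ [])
  ∷ (# 0 ∷ # 4 ∷ # 10 ∷ [])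
  ∷ []
  ∷ (# 1 ∷ # 2 ∷ # 10 ∷ [])
  ∷ (# 3 ∷ # 11 ∷ # 13 ∷ [])
  ∷ (# 3 ∷ # 12 ∷ # 14 ∷ [])
  ∷ []
  ∷ (# 6 ∷ # 14 ∷ [])
  ∷ (# 7 ∷ # 10 ∷ [])
  ∷ (# 5 ∷ # 10 ∷ # 11 ∷ [])
  ∷ (# 6 ∷ # 12 ∷ [])
  ∷ [])

Arc : Fin 15 → Fin 15 → Set
Arc = GalvinArc petersen φ inU

successors-correct : ∀ e f → (Arc e f → f ∈ₗ successors e) × (f ∈ₗ successors e → Arc e f)
successors-correct = from-yes
  (all? λ e → all? λ f →
     (galvinArc? petersen φ inU e f →-dec Any.any? (f ≟_) (successors e)) ×-dec
     (Any.any? (f ≟_) (successors e) →-dec galvinArc? petersen φ inU e f))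

-- Deciding arcs through the table is much faster than through the definition.
arc? : Decidable Arc
arc? e f = map′ (proj₂ (successors-correct e f)) (proj₁ (successors-correct e f))
                (Any.any? (f ≟_) (successors e))

open Kernels arc? using (SinkFree; nonSinks; sinkFree⊆nonSinks; sinkFree?; isKernel?; kernelPerfect)

setOf : List (Fin 15) → Subset 15
setOf = ⋃ ∘ map ⁅_⁆

-- Candidate kernels: every sink-free S has a kernel S ∩ T for one of these T.
kernelTemplates : List (Subset 15)
kernelTemplates =
    setOf (# 0 ∷ # 2 ∷ # 11 ∷ # 12 ∷ [])
  ∷ setOf (# 0 ∷ # 2 ∷ # 4 ∷ # 11 ∷ # 12 ∷ # 13 ∷ [])
  ∷ setOf (# 0 ∷ # 2 ∷ # 12 ∷ # 13 ∷ [])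
  ∷ setOf (# 2 ∷ # 4 ∷ # 11 ∷ # 12 ∷ [])
  ∷ []

HasTemplateKernel : Subset 15 → Set
HasTemplateKernel S = SinkFree S → Any (λ T → IsKernelOf Arc S (S ∩ T)) kernelTemplates

hasTemplateKernel? : U.Decidable HasTemplateKernel
hasTemplateKernel? S = sinkFree? S →-dec Any.any? (λ T → isKernel? S (S ∩ T)) kernelTemplates

-- Checked by evaluation over the 2¹² subsets of the non-sinks; a sink-free S is one of them.
templateKernel : ∀ S → HasTemplateKernel S
templateKernel S sinkFree =
  everySubsetOf hasTemplateKernel? nonSinks refl S (sinkFree⊆nonSinks sinkFree) sinkFree

sinkFreeKernel : ∀ S → SinkFree S → ∃[ K ] IsKernelOf Arc S K
sinkFreeKernel S sinkFree =
  let template , kernel = Any.satisfied (templateKernel S sinkFree) in S ∩ template , kernel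

theorem4 : HasProperGalvinOrientation petersen 4
theorem4 = inU , φ , colouring , kernelPerfect sinkFreeKernel , outdegree
  where
  colouring : IsEdgeColouring petersen 4 φ
  colouring = from-yes (isEdgeColouring? petersen 4 φ)
  outdegree : ∀ e → galvinOutdeg petersen φ inU e ≤ 3
  outdegree = from-yes (outdegreeBounded? petersen 4 φ inU)
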